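{- Let $G=(V,E)$ be a tree, $T$ a search tree on $G$, and $S\subseteq V$ such that $G[S]$ is connected. Then the projection $T|S$ is obtained from $T$ by applying the following operation to each connected component $C$ of $T[V\setminus S]$ (the subgraph of $T$ induced by $V\setminus S$): if two vertices of $T$ not in $C$ have a neighbor (in $T$) in $C$, replace $C$ by a single edge joining these two vertices; otherwise only one vertex $v$ of $T$ not in $C$ has a neighbor in $C$, and then delete $C$, and if $C$ contains the root of $T$, choose $v$ as the root of $T|S$.
   Context: All graphs are simple and undirected. For a connected graph $G=(V,E)$, a search tree on $G$ is a rooted tree $T$ with vertex set $V$ and some root $r\in V$, defined recursively: if $|V|=1$, $T$ is the single vertex $r$; otherwise $G-r$ has some $k\ge1$ connected components and $T$ consists of $r$ joined to the roots of $k$ search trees, one on each component. Pruning: if $G$ is a tree with $|V|>1$, $x$ is a leaf (degree-one vertex) of $G$ and $T$ a search tree on $G$, pruning $x$ from $T$ yields a search tree on $G-x$ as follows: if $x$ has a parent but no child in $T$, delete $x$; if $x$ has a parent and a single child in $T$, replace the two edges from $x$ to its parent and child by a single edge between the parent and the child; if $x$ is the root of $T$ (then it has one child), delete $x$ and make its child the new root. Projection: for $S\subseteq V$ with $G[S]$ connected, the projection $T|S$ is the search tree on $G[S]$ defined inductively: if $|V\setminus S|=1$, $T|S$ is the result of pruning the unique $x\in V\setminus S$ from $T$; otherwise pick any $x\in V\setminus S$ adjacent in $G$ to a vertex of $S$, let $S'=S\cup\{x\}$, and let $T|S$ be the result of pruning $x$ from $T|S'$ (the result does not depend on these choices). -}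

module Defs where

open import Data.Nat using (ℕ; _≤_)
open import Data.Bool using (Bool; T)
open import Data.Fin using (Fin)
open import Data.Fin.Subset using (Subset; _∈_; _∉_; _⊆_; ⊤; ∁; _∪_; _-_; ⁅_⁆; Nonempty)
open import Data.Maybe using (Maybe; just; nothing)
open import Data.List using (List; []; _∷_; _++_; [_]; length)
open import Data.List.Relation.Unary.Unique.Propositional using (Unique)
open import Data.Product using (Σ; _×_; _,_)
open import Data.Sum using (_⊎_)
open import Data.Unit using () renaming (⊤ to Unit)
open import Relation.Nullary using (¬_)
open import Data.Empty using (⊥)
open import Relation.Binary.PropositionalEquality using (_≡_; _≢_)
open import Function.Bundles using (_⇔_)

record Graph (n : ℕ) : Set where
  field
    adj    : Fin n → Fin n → Bool
    sym    : ∀ u v → T (adj u v) → T (adj v u)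
    irrefl : ∀ u → ¬ T (adj u u)

open Graph public

Adj : ∀ {n} → Graph n → Fin n → Fin n → Set
Adj G u v = T (adj G u v)

-- A subset S is the vertex set of the
-- induced subgraph; a walk "in A[S]" uses only vertices of S.

data Walk {n} (A : Fin n → Fin n → Set) (S : Subset n) : Fin n → Fin n → Set where
  here  : ∀ {u} → u ∈ S → Walk A S u u
  there : ∀ {u w v} → u ∈ S → A u w → Walk A S w v → Walk A S u v

Connected : ∀ {n} → (Fin n → Fin n → Set) → Subset n → Set
Connected A S = Nonempty S × (∀ {u v} → u ∈ S → v ∈ S → Walk A S u v)

Component : ∀ {n} → (Fin n → Fin n → Set) → Subset n → Subset n → Set
Component A S C = C ⊆ S × Connected A C × (∀ {u v} → u ∈ C → v ∈ S → A u v → v ∈ C)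

Chain : ∀ {n} → (Fin n → Fin n → Set) → List (Fin n) → Set
Chain A []           = Unit
Chain A (x ∷ [])     = Unit
Chain A (x ∷ y ∷ ys) = A x y × Chain A (y ∷ ys)

IsCycle : ∀ {n} → (Fin n → Fin n → Set) → List (Fin n) → Set
IsCycle A []       = ⊥
IsCycle A (v ∷ vs) = 3 ≤ length (v ∷ vs) × Unique (v ∷ vs) × Chain A ((v ∷ vs) ++ [ v ])

IsTree : ∀ {n} → Graph n → Set
IsTree G = Connected (Adj G) ⊤ × (∀ vs → ¬ IsCycle (Adj G) vs)

-- Rooted trees on (a subset of) Fin n, given by a root and a parent map.
-- Vertices outside the vertex set, and the root, have parent nothing.

record RTree (n : ℕ) : Set where
  constructor rtree
  field
    root   : Fin n
    parent : Fin n → Maybe (Fin n)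

open RTree public

TAdj : ∀ {n} → RTree n → Fin n → Fin n → Set
TAdj R u v = parent R u ≡ just v ⊎ parent R v ≡ just u

data IsSearchTree {n} (G : Graph n) : Subset n → RTree n → Set where
  node : ∀ {S T}
       → root T ∈ S
       → parent T (root T) ≡ nothing
       → (∀ v → v ∉ S → parent T v ≡ nothing)
       → (∀ C → Component (Adj G) (S - root T) C →
            Σ (RTree n) λ T' → IsSearchTree G C T'
              × parent T (root T') ≡ just (root T)
              × (∀ v → v ∈ C → v ≢ root T' → parent T v ≡ parent T' v))
       → IsSearchTree G S T

data Prune {n} (T : RTree n) (x : Fin n) (T' : RTree n) : Set where
  noChild  : ∀ p → parent T x ≡ just p → (∀ v → parent T v ≢ just x)
           → root T' ≡ root T → parent T' x ≡ nothing
           → (∀ v → v ≢ x → parent T' v ≡ parent T v)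
           → Prune T x T'
  oneChild : ∀ p c → parent T x ≡ just p → parent T c ≡ just x
           → (∀ v → parent T v ≡ just x → v ≡ c)
           → root T' ≡ root T → parent T' x ≡ nothing → parent T' c ≡ just p
           → (∀ v → v ≢ x → v ≢ c → parent T' v ≡ parent T v)
           → Prune T x T'
  isRoot   : ∀ c → root T ≡ x → parent T c ≡ just x
           → (∀ v → parent T v ≡ just x → v ≡ c)
           → root T' ≡ c → parent T' x ≡ nothing → parent T' c ≡ nothing
           → (∀ v → v ≢ x → v ≢ c → parent T' v ≡ parent T v)
           → Prune T x T'

data Proj {n} (G : Graph n) (T : RTree n) : Subset n → RTree n → Set where
  whole : ∀ {S R} → (∀ v → v ∈ S)
        → root R ≡ root T → (∀ v → parent R v ≡ parent T v)
        → Proj G T S R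
  step  : ∀ {S R' R} (x s : Fin n) → x ∉ S → s ∈ S → Adj G x s
        → Proj G T (S ∪ ⁅ x ⁆) R' → Prune R' x R
        → Proj G T S R

Boundary : ∀ {n} → RTree n → Subset n → Fin n → Set
Boundary T C w = w ∉ C × Σ _ λ u → u ∈ C × TAdj T w u

OutComp : ∀ {n} → RTree n → Subset n → Subset n → Set
OutComp T S C = Component (TAdj T) (∁ S) C

record Described {n} (T : RTree n) (S : Subset n) (R : RTree n) : Set where
  field
    shape  : ∀ C → OutComp T S C →
               (Σ _ λ a → Σ _ λ b → a ≢ b × (∀ w → Boundary T C w ⇔ (w ≡ a ⊎ w ≡ b)))
               ⊎ (Σ _ λ v → ∀ w → Boundary T C w ⇔ w ≡ v)
    edges  : ∀ u v → TAdj R u v ⇔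
               ((u ∈ S × v ∈ S × TAdj T u v)
                ⊎ (Σ _ λ C → OutComp T S C × u ≢ v × Boundary T C u × Boundary T C v))
    rootIn  : root T ∈ S → root R ≡ root T
    rootOut : ∀ C → OutComp T S C → root T ∈ C → ∀ w → Boundary T C w ⇔ w ≡ root R

-- Let R(S) be the rooted tree on S in which every vertex hangs from its nearest proper T-ancestor
-- in S. Two properties of search trees on a tree G drive the argument: every edge of G joins a
-- vertex to one of its T-ancestors, and the T-subtree of every vertex induces a connected subgraph
-- of G adjacent to the parent of that vertex. So if S is connected, no vertex outside S can have
-- two child subtrees reaching S through vertices outside S: a walk inside S would join them and
-- close a cycle of G. Hence pruning the leaf x from R(S ∪ {x}) is always possible and gives R(S),
-- so T|S = R(S); and a component C of T[V ∖ S] is bordered only by the parent of its top vertex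
-- and by at most one vertex of S hanging below it, which R(S) joins directly.

module Submission where

open import Defs hiding (sym)
open import Data.Nat using (ℕ; zero; suc; _+_; _≤_; _<_; z≤n; s≤s)
open import Data.Nat.Properties
  using (≤-trans; ≤-refl; <-irrefl; ≤-<-trans; <-≤-trans; n≤1+n; ≤-pred; +-suc; +-monoʳ-≤; m≤m+n)
open import Data.Bool using (Bool; true; T; T?)
open import Data.Bool.Properties using (T-≡)
open import Data.Fin using (Fin) renaming (_≟_ to _≟F_)
open import Data.Fin.Subset using (Subset; _∈_; _∉_; _⊆_; ⊤; ∁; _∪_; _─_; _-_; ⁅_⁆; Nonempty; ∣_∣; inside)
open import Data.Fin.Subset.Properties
  using (_∈?_; ∈⊤; x∈p⇒∣p-x∣<∣p∣; x∈p∧x≢y⇒x∈p-y; x∈∁p⇒x∉p; x∉p⇒x∈∁p; x∈p∪q⁻; x∈p∪q⁺; x∈⁅x⁆; x∈⁅y⁆⇒x≡y;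
         p─q⊆p; p⊂q⇒∣p∣<∣q∣; ∣⊤∣≡n)
open import Data.Fin.Properties using (any?; all?; ¬∀⟶∃¬)
open import Data.Vec using (tabulate; _∷_; here; there)
open import Data.Vec.Properties using (lookup∘tabulate; []=⇒lookup; lookup⇒[]=)
open import Data.Maybe using (Maybe; just; nothing)
open import Data.Maybe.Properties using (just-injective; ≡-dec)
open import Data.List using (List; []; _∷_; _++_; [_]; length)
open import Data.List.Relation.Unary.All using (All; []; _∷_)
import Data.List.Relation.Unary.All as All
open import Data.List.Relation.Unary.All.Properties using (¬Any⇒All¬)
open import Data.List.Relation.Unary.Any using (Any; here; there)
import Data.List.Relation.Unary.Any as Any
open import Data.List.Relation.Unary.Unique.Propositional using (Unique)
open import Data.List.Relation.Unary.AllPairs using ([]; _∷_)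
open import Data.Product using (Σ; _×_; _,_; proj₁; proj₂; ∃)
open import Data.Sum using (_⊎_; inj₁; inj₂; [_,_]′) renaming (map to ⊎-map)
open import Data.Unit using (tt)
open import Data.Empty using (⊥; ⊥-elim)
open import Relation.Nullary using (¬_; Dec; yes; no; _×-dec_; ¬?)
open import Relation.Nullary.Decidable using (isYes; toWitness; fromWitness; decidable-stable)
open import Relation.Nullary.Decidable.Core using (_⊎-dec_)
open import Relation.Binary.PropositionalEquality using (_≡_; _≢_; refl; sym; trans; cong; subst)
open import Function.Bundles using (_⇔_; mk⇔; Equivalence)

Rel : ℕ → Set₁
Rel n = Fin n → Fin n → Set

data PWalk {n} (A : Rel n) (P : Fin n → Set) : Fin n → Fin n → Set where
  pnil  : ∀ {u} → P u → PWalk A P u u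
  pcons : ∀ {u w v} → P u → A u w → PWalk A P w v → PWalk A P u v

module _ {n : ℕ} {A : Rel n} where

  pwalk-start : ∀ {P u v} → PWalk A P u v → P u
  pwalk-start (pnil p)      = p
  pwalk-start (pcons p _ _) = p

  pwalk-end : ∀ {P u v} → PWalk A P u v → P v
  pwalk-end (pnil p)      = p
  pwalk-end (pcons _ _ q) = pwalk-end q

  pwalk-++ : ∀ {P u v w} → PWalk A P u v → PWalk A P v w → PWalk A P u w
  pwalk-++ (pnil _)      q = q
  pwalk-++ (pcons p a r) q = pcons p a (pwalk-++ r q)

  pwalk-snoc : ∀ {P u v w} → PWalk A P u v → A v w → P w → PWalk A P u w
  pwalk-snoc q a pw = pwalk-++ q (pcons (pwalk-end q) a (pnil pw))

  pwalk-map : ∀ {P Q : Fin n → Set} {u v} → (∀ {z} → P z → Q z) → PWalk A P u v → PWalk A Q u v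
  pwalk-map f (pnil p)      = pnil (f p)
  pwalk-map f (pcons p a q) = pcons (f p) a (pwalk-map f q)

  pwalk-reverse : ∀ {P u v} → (∀ {a b} → A a b → A b a) → PWalk A P u v → PWalk A P v u
  pwalk-reverse s (pnil p)      = pnil p
  pwalk-reverse s (pcons p a q) = pwalk-snoc (pwalk-reverse s q) (s a) p

  pwalk-relabel : ∀ {P Q : Fin n → Set} {u v} → (∀ {a b} → Q a → P a → A a b → P b → Q b)
                → Q u → PWalk A P u v → PWalk A Q u v
  pwalk-relabel f q (pnil _)      = pnil q
  pwalk-relabel f q (pcons p a r) = pcons q a (pwalk-relabel f (f q p a (pwalk-start r)) r)

  pwalk-invariant : ∀ {P Q : Fin n → Set} {u v} → (∀ {a b} → Q a → P a → A a b → P b → Q b)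
                  → Q u → PWalk A P u v → Q v
  pwalk-invariant f q r = pwalk-end (pwalk-relabel f q r)

  walk⇒pwalk : ∀ {S u v} → Walk A S u v → PWalk A (_∈ S) u v
  walk⇒pwalk (here p)      = pnil p
  walk⇒pwalk (there p a q) = pcons p a (walk⇒pwalk q)

  pwalk⇒walk : ∀ {S u v} → PWalk A (_∈ S) u v → Walk A S u v
  pwalk⇒walk (pnil p)      = here p
  pwalk⇒walk (pcons p a q) = there p a (pwalk⇒walk q)

  first-entry : ∀ {P Q : Fin n → Set} → (∀ z → Dec (Q z)) → ∀ {a b}
              → PWalk A P a b → ¬ Q a → Q b
              → Σ _ λ u → Σ _ λ w → P u × P w × ¬ Q u × Q w × A u w
  first-entry Q? (pnil _) ¬qa qb = ⊥-elim (¬qa qb)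
  first-entry Q? (pcons {w = w} pa e q) ¬qa qb with Q? w
  ... | yes qw  = _ , w , pa , pwalk-start q , ¬qa , qw , e
  ... | no ¬qw = first-entry Q? q ¬qw qb

  vertices : ∀ {P u v} → PWalk A P u v → List (Fin n)
  vertices {u = u} (pnil _)      = [ u ]
  vertices {u = u} (pcons _ _ q) = u ∷ vertices q

  vertices-all : ∀ {P u v} (q : PWalk A P u v) → All P (vertices q)
  vertices-all (pnil p)      = p ∷ []
  vertices-all (pcons p _ q) = p ∷ vertices-all q

  chain-vertices : ∀ {P u v x} (q : PWalk A P u v) → A v x → Chain A (vertices q ++ [ x ])
  chain-vertices (pnil _)                    b = b , tt
  chain-vertices (pcons _ a (pnil _))        b = a , b , tt
  chain-vertices (pcons _ a q@(pcons _ _ _)) b = a , chain-vertices q b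

  Path : (Fin n → Set) → Fin n → Fin n → Set
  Path P u v = Σ (PWalk A P u v) λ q → Unique (vertices q)

  suffix-path : ∀ {P u w v} (q : PWalk A P w v) → Any (u ≡_) (vertices q) → Unique (vertices q)
              → Path P u v
  suffix-path q@(pnil _)      (here refl) uq       = q , uq
  suffix-path q@(pcons _ _ _) (here refl) uq       = q , uq
  suffix-path (pcons _ _ q)   (there m)   (_ ∷ uq) = suffix-path q m uq

  walk⇒path : ∀ {P u v} → PWalk A P u v → Path P u v
  walk⇒path (pnil p) = pnil p , [] ∷ []
  walk⇒path {u = u} (pcons p a r) with walk⇒path r
  ... | q , uq with Any.any? (u ≟F_) (vertices q)
  ...   | yes m  = suffix-path q m uq
  ...   | no ¬m = pcons p a q , ¬Any⇒All¬ (vertices q) ¬m ∷ uq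

  -- Shortened to a path, the walk is closed by x into a cycle: x is off the walk and z₁ ≢ z₂.
  acyclic⇒no-detour : ∀ {P x z₁ z₂} → (∀ vs → ¬ IsCycle A vs) → ¬ P x → A x z₁ → A z₂ x → z₁ ≢ z₂
                    → ¬ PWalk A P z₁ z₂
  acyclic⇒no-detour {P} {x} acyclic ¬px a₁ a₂ z₁≢z₂ q₀ with walk⇒path q₀
  ... | pnil _ , _ = z₁≢z₂ refl
  ... | q@(pcons _ _ r) , uq = acyclic (x ∷ vertices q) (long r , (x∉q ∷ uq) , a₁ , chain-vertices q a₂)
    where
      long : ∀ {w v} (r : PWalk A P w v) → 3 ≤ suc (suc (length (vertices r)))
      long (pnil _)      = s≤s (s≤s (s≤s z≤n))
      long (pcons _ _ _) = s≤s (s≤s (s≤s z≤n))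
      x∉q : All (x ≢_) (vertices q)
      x∉q = All.map (λ pz x≡z → ¬px (subst P (sym x≡z) pz)) (vertices-all q)

x∈p─q⇒x∉q : ∀ {n} {x : Fin n} (p q : Subset n) → x ∈ p ─ q → x ∉ q
x∈p─q⇒x∉q (_ ∷ p) (_      ∷ q) (there x∈) (there x∈q) = x∈p─q⇒x∉q p q x∈ x∈q
x∈p─q⇒x∉q (_ ∷ p) (inside ∷ q) ()         here

x∈p-y⇒x≢y : ∀ {n} {x y : Fin n} (p : Subset n) → x ∈ p - y → x ≢ y
x∈p-y⇒x≢y {y = y} p x∈ refl = x∈p─q⇒x∉q p ⁅ y ⁆ x∈ (x∈⁅x⁆ y)

x∈p-y⇒x∈p : ∀ {n} {x y : Fin n} (p : Subset n) → x ∈ p - y → x ∈ p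
x∈p-y⇒x∈p {y = y} p = p─q⊆p p ⁅ y ⁆

∈-tabulate⁻ : ∀ {n} {f : Fin n → Bool} {w} → w ∈ tabulate f → f w ≡ true
∈-tabulate⁻ {f = f} {w} m = trans (sym (lookup∘tabulate f w)) ([]=⇒lookup m)

∈-tabulate⁺ : ∀ {n} {f : Fin n → Bool} {w} → f w ≡ true → w ∈ tabulate f
∈-tabulate⁺ {f = f} {w} e = lookup⇒[]= w (tabulate f) (trans (lookup∘tabulate f w) e)

module Components {n : ℕ} (A : Rel n) (A? : ∀ a b → Dec (A a b)) (A-sym : ∀ {a b} → A a b → A b a) where

  walk-avoiding : ∀ {S a v} u → PWalk A (_∈ S) a v → u ≢ v
                → PWalk A (_∈ S - u) a v ⊎ Σ _ (λ w → A u w × PWalk A (_∈ S - u) w v)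
  walk-avoiding u (pnil p) u≢v = inj₁ (pnil (x∈p∧x≢y⇒x∈p-y p (λ e → u≢v (sym e))))
  walk-avoiding u (pcons {a} p e q) u≢v with walk-avoiding u q u≢v
  ... | inj₂ r = inj₂ r
  ... | inj₁ r with a ≟F u
  ...   | yes refl = inj₂ (_ , e , r)
  ...   | no a≢u   = inj₁ (pcons (x∈p∧x≢y⇒x∈p-y p a≢u) e r)

  -- Fuel k bounds ∣ S ∣, which drops when the start vertex is removed.
  reachable? : ∀ k (S : Subset n) → ∣ S ∣ ≤ k → ∀ u v → Dec (PWalk A (_∈ S) u v)
  reachable? k S bound u v with u ∈? S
  ... | no u∉ = no (λ q → u∉ (pwalk-start q))
  ... | yes u∈ with u ≟F v
  ...   | yes refl = yes (pnil u∈)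
  ...   | no u≢v   = search k bound
    where
      search : ∀ k → ∣ S ∣ ≤ k → Dec (PWalk A (_∈ S) u v)
      search zero    bound′ = ⊥-elim (<-irrefl refl (≤-<-trans z≤n (<-≤-trans (x∈p⇒∣p-x∣<∣p∣ u∈) bound′)))
      search (suc k) bound′ with any? (λ w → A? u w ×-dec reachable? k (S - u) bound″ w v)
        where bound″ = ≤-pred (<-≤-trans (x∈p⇒∣p-x∣<∣p∣ u∈) bound′)
      ... | yes (w , a , q) = yes (pcons u∈ a (pwalk-map (x∈p-y⇒x∈p S) q))
      ... | no ∄w = no λ q → [ (λ q′ → x∈p-y⇒x≢y S (pwalk-start q′) refl) , ∄w ]′ (walk-avoiding u q u≢v)

  component : Subset n → Fin n → Subset n
  component S v = tabulate (λ w → isYes (reachable? ∣ S ∣ S ≤-refl v w))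

  ∈-component⁻ : ∀ {S v w} → w ∈ component S v → PWalk A (_∈ S) v w
  ∈-component⁻ {S} {v} {w} m =
    toWitness {a? = reachable? ∣ S ∣ S ≤-refl v w} (Equivalence.from T-≡ (∈-tabulate⁻ m))

  ∈-component⁺ : ∀ {S v w} → PWalk A (_∈ S) v w → w ∈ component S v
  ∈-component⁺ {S} {v} {w} q = ∈-tabulate⁺ (Equivalence.to T-≡ (fromWitness {a? = reachable? ∣ S ∣ S ≤-refl v w} q))

  component-isComponent : ∀ {S v} → v ∈ S → Component A S (component S v)
  component-isComponent {S} {v} v∈ = ⊆S , (nonempty , connected) , closed
    where
      C = component S v
      ⊆S : C ⊆ S
      ⊆S m = pwalk-end (∈-component⁻ m)
      nonempty : Nonempty C
      nonempty = v , ∈-component⁺ (pnil v∈)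
      extend : ∀ {a b} → PWalk A (_∈ S) v a → a ∈ S → A a b → b ∈ S → PWalk A (_∈ S) v b
      extend q _ e b∈ = pwalk-snoc q e b∈
      connected : ∀ {a b} → a ∈ C → b ∈ C → Walk A C a b
      connected a∈ b∈ = pwalk⇒walk (pwalk-map ∈-component⁺
        (pwalk-relabel extend (∈-component⁻ a∈)
          (pwalk-++ (pwalk-reverse A-sym (∈-component⁻ a∈)) (∈-component⁻ b∈))))
      closed : ∀ {u w} → u ∈ C → w ∈ S → A u w → w ∈ C
      closed u∈ w∈ e = ∈-component⁺ (pwalk-snoc (∈-component⁻ u∈) e w∈)

  ∈-component-self : ∀ {S v} → v ∈ S → v ∈ component S v
  ∈-component-self v∈ = ∈-component⁺ (pnil v∈)

component-closed : ∀ {n} {A : Rel n} {S C u y} → Component A S C → u ∈ C → PWalk A (_∈ S) u y → y ∈ C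
component-closed c u∈ (pnil _)      = u∈
component-closed c u∈ (pcons _ e q) = component-closed c (proj₂ (proj₂ c) u∈ (pwalk-start q) e) q

nothing≢just : ∀ {a} {A : Set a} {x : A} → nothing ≢ just x
nothing≢just ()

module Ancestry {n : ℕ} (par : Fin n → Maybe (Fin n)) where

  data Anc : Fin n → Fin n → Set where
    self : ∀ {v} → Anc v v
    up   : ∀ {v u w} → par v ≡ just u → Anc u w → Anc v w

  parent-unique : ∀ {v u u′} → par v ≡ just u → par v ≡ just u′ → u ≡ u′
  parent-unique e e′ = just-injective (trans (sym e) e′)

  no-parent : ∀ {v u} → par v ≡ nothing → par v ≢ just u
  no-parent e e′ = nothing≢just (trans (sym e) e′)

  anc-trans : ∀ {a b c} → Anc a b → Anc b c → Anc a c
  anc-trans self     q = q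
  anc-trans (up e p) q = up e (anc-trans p q)

  anc-parentless : ∀ {v w} → par v ≡ nothing → Anc v w → v ≡ w
  anc-parentless e self      = refl
  anc-parentless e (up e′ _) = ⊥-elim (no-parent e e′)

  anc-comparable : ∀ {u w a} → Anc u w → Anc u a → Anc w a ⊎ Anc a w
  anc-comparable self     q        = inj₁ q
  anc-comparable (up e p) self     = inj₂ (up e p)
  anc-comparable (up e p) (up e′ q) with parent-unique e e′
  ... | refl = anc-comparable p q

  anc-length : ∀ {v w} → Anc v w → ℕ
  anc-length self     = 0
  anc-length (up _ p) = suc (anc-length p)

  anc-length-unique : ∀ {r v} → par r ≡ nothing → (p q : Anc v r) → anc-length p ≡ anc-length q
  anc-length-unique pr self     self      = refl
  anc-length-unique pr self     (up e _)  = ⊥-elim (no-parent pr e)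
  anc-length-unique pr (up e _) self      = ⊥-elim (no-parent pr e)
  anc-length-unique pr (up e p) (up e′ q) with parent-unique e e′
  ... | refl = cong suc (anc-length-unique pr p q)

  data Desc : Fin n → Fin n → Set where
    self : ∀ {v} → Desc v v
    down : ∀ {w d v} → par d ≡ just w → Desc d v → Desc w v

  desc-snoc : ∀ {w u v} → Desc w u → par v ≡ just u → Desc w v
  desc-snoc self       e = down e self
  desc-snoc (down e p) e′ = down e (desc-snoc p e′)

  anc⇒desc : ∀ {v w} → Anc v w → Desc w v
  anc⇒desc self     = self
  anc⇒desc (up e p) = desc-snoc (anc⇒desc p) e

  module _ (S : Subset n) where

    data NearestIn : Fin n → Fin n → Set where
      parent-in : ∀ {v w}   → par v ≡ just w → w ∈ S → NearestIn v w
      skip      : ∀ {v u w} → par v ≡ just u → u ∉ S → NearestIn u w → NearestIn v w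

    data NoAncestorIn : Fin n → Set where
      parentless : ∀ {v}   → par v ≡ nothing → NoAncestorIn v
      skip       : ∀ {v u} → par v ≡ just u → u ∉ S → NoAncestorIn u → NoAncestorIn v

  module _ {S : Subset n} where

    nearest-unique : ∀ {v w w′} → NearestIn S v w → NearestIn S v w′ → w ≡ w′
    nearest-unique (parent-in e _)   (parent-in e′ _)  = parent-unique e e′
    nearest-unique (parent-in e w∈)  (skip e′ u∉ _)    with parent-unique e e′
    ... | refl = ⊥-elim (u∉ w∈)
    nearest-unique (skip e u∉ _)     (parent-in e′ w∈) with parent-unique e e′
    ... | refl = ⊥-elim (u∉ w∈)
    nearest-unique (skip e _ p)      (skip e′ _ q)     with parent-unique e e′
    ... | refl = nearest-unique p q

    nearest-noAncestor : ∀ {v w} → NearestIn S v w → ¬ NoAncestorIn S v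
    nearest-noAncestor (parent-in e _)  (parentless e′)  = no-parent e′ e
    nearest-noAncestor (parent-in e w∈) (skip e′ u∉ _)   with parent-unique e e′
    ... | refl = u∉ w∈
    nearest-noAncestor (skip e _ _)     (parentless e′)  = no-parent e′ e
    nearest-noAncestor (skip e _ p)     (skip e′ _ q)    with parent-unique e e′
    ... | refl = nearest-noAncestor p q

    nearest-∈ : ∀ {v w} → NearestIn S v w → w ∈ S
    nearest-∈ (parent-in _ w∈) = w∈
    nearest-∈ (skip _ _ p)     = nearest-∈ p

    nearest⇒anc : ∀ {v w} → NearestIn S v w → Anc v w
    nearest⇒anc (parent-in e _) = up e self
    nearest⇒anc (skip e _ p)    = up e (nearest⇒anc p)

    nearest-or-noAncestor : ∀ {v r} → par r ≡ nothing → Anc v r → (∃ λ w → NearestIn S v w) ⊎ NoAncestorIn S v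
    nearest-or-noAncestor pr self = inj₂ (parentless pr)
    nearest-or-noAncestor pr (up {u = u} e p) with u ∈? S
    ... | yes u∈ = inj₁ (u , parent-in e u∈)
    ... | no u∉ with nearest-or-noAncestor pr p
    ...   | inj₁ (w , q) = inj₁ (w , skip e u∉ q)
    ...   | inj₂ q       = inj₂ (skip e u∉ q)

    noAncestor-anc : ∀ {v w} → NoAncestorIn S v → Anc v w → w ∈ S → v ≡ w
    noAncestor-anc _                  self     _  = refl
    noAncestor-anc (parentless e′)    (up e _) _  = ⊥-elim (no-parent e′ e)
    noAncestor-anc (skip e′ u∉ none)  (up e p) w∈ with parent-unique e e′
    ... | refl with noAncestor-anc none p w∈
    ...   | refl = ⊥-elim (u∉ w∈)

  module _ (S : Subset n) where

    data Hanging (l : Fin n) : Fin n → Set where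
      child : ∀ {v}   → par v ≡ just l → Hanging l v
      below : ∀ {d v} → par d ≡ just l → d ∉ S → Hanging d v → Hanging l v

  module _ {S : Subset n} where

    hanging⇒anc : ∀ {l v} → Hanging S l v → Anc v l
    hanging⇒anc (child e)     = up e self
    hanging⇒anc (below e _ h) = anc-trans (hanging⇒anc h) (up e self)

    hanging-extend : ∀ {l u v} → Hanging S l u → par v ≡ just u → u ∉ S → Hanging S l v
    hanging-extend (child e)     e′ u∉ = below e u∉ (child e′)
    hanging-extend (below e d∉ h) e′ u∉ = below e d∉ (hanging-extend h e′ u∉)

    hanging-++-nearest : ∀ {u v w} → Hanging S u v → u ∉ S → NearestIn S u w → NearestIn S v w
    hanging-++-nearest (child e)      u∉ q = skip e u∉ q
    hanging-++-nearest (below e d∉ h) u∉ q = hanging-++-nearest h d∉ (skip e u∉ q)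

    hanging-++-noAncestor : ∀ {u v} → Hanging S u v → u ∉ S → NoAncestorIn S u → NoAncestorIn S v
    hanging-++-noAncestor (child e)      u∉ none = skip e u∉ none
    hanging-++-noAncestor (below e d∉ h) u∉ none = hanging-++-noAncestor h d∉ (skip e u∉ none)

    hanging⇒nearest : ∀ {l v} → Hanging S l v → l ∈ S → NearestIn S v l
    hanging⇒nearest (child e)      l∈ = parent-in e l∈
    hanging⇒nearest (below e d∉ h) l∈ = hanging-++-nearest h d∉ (parent-in e l∈)

    first-hanging : ∀ {l v} → Desc l v → v ∈ S → l ≢ v → ∃ λ c → c ∈ S × Hanging S l c
    first-hanging self                  _  l≢v = ⊥-elim (l≢v refl)
    first-hanging (down {d = d} e p) v∈ _ with d ∈? S
    ... | yes d∈ = d , d∈ , child e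
    ... | no d∉ with first-hanging p v∈ (λ { refl → d∉ v∈ })
    ...   | c , c∈ , h = c , c∈ , below e d∉ h

    nearest⇒hanging : ∀ {S′ v w} → S ⊆ S′ → NearestIn S′ v w → Hanging S w v
    nearest⇒hanging _     (parent-in e _) = child e
    nearest⇒hanging S⊆S′ (skip e u∉ q)   = hanging-extend (nearest⇒hanging S⊆S′ q) e (λ u∈ → u∉ (S⊆S′ u∈))

    noAncestor-⊆ : ∀ {S′ v} → S ⊆ S′ → NoAncestorIn S′ v → NoAncestorIn S v
    noAncestor-⊆ _     (parentless e) = parentless e
    noAncestor-⊆ S⊆S′ (skip e u∉ q)  = skip e (λ u∈ → u∉ (S⊆S′ u∈)) (noAncestor-⊆ S⊆S′ q)

  module Rooted (r : Fin n) (r-parentless : par r ≡ nothing) (anc-root : ∀ v → Anc v r) where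

    depth : Fin n → ℕ
    depth v = anc-length (anc-root v)

    depth-parent : ∀ {v u} → par v ≡ just u → depth v ≡ suc (depth u)
    depth-parent {v} {u} e with anc-root v
    ... | self = ⊥-elim (no-parent r-parentless e)
    ... | up e′ p with parent-unique e e′
    ...   | refl = cong suc (anc-length-unique r-parentless p (anc-root u))

    depth-anc : ∀ {v w} → Anc v w → depth w ≤ depth v
    depth-anc self = ≤-refl
    depth-anc (up e p) rewrite depth-parent e = ≤-trans (depth-anc p) (n≤1+n _)

    depth-anc< : ∀ {v w} → Anc v w → v ≢ w → depth w < depth v
    depth-anc< self     v≢w = ⊥-elim (v≢w refl)
    depth-anc< (up e p) _   rewrite depth-parent e = s≤s (depth-anc p)

    anc-antisym : ∀ {v w} → Anc v w → Anc w v → v ≡ w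
    anc-antisym {v} {w} p q with v ≟F w
    ... | yes v≡w = v≡w
    ... | no v≢w  = ⊥-elim (<-irrefl refl (≤-<-trans (depth-anc q) (depth-anc< p v≢w)))

    parent-¬anc : ∀ {v u} → par v ≡ just u → ¬ Anc u v
    parent-¬anc e q = <-irrefl refl (≤-<-trans (depth-anc q) (subst (depth _ <_) (sym (depth-parent e)) ≤-refl))

    parentless⇒root : ∀ {v} → par v ≡ nothing → v ≡ r
    parentless⇒root {v} e = anc-parentless e (anc-root v)

    anc? : ∀ v m → Dec (Anc v m)
    anc? v m = climb (anc-root v)
      where
        climb : ∀ {v} → Anc v r → Dec (Anc v m)
        climb {v} p with v ≟F m
        ... | yes refl = yes self
        ... | no v≢m with p
        ...   | self = no λ { self → v≢m refl ; (up e _) → no-parent r-parentless e }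
        ...   | up e p′ with climb p′
        ...     | yes q = yes (up e q)
        ...     | no ¬q = no λ { self → v≢m refl ; (up e′ q) → ¬q (subst (λ z → Anc z m) (parent-unique e′ e) q) }

    nearest-or-noAncestor-at : ∀ S v → (∃ λ w → NearestIn S v w) ⊎ NoAncestorIn S v
    nearest-or-noAncestor-at S v = nearest-or-noAncestor r-parentless (anc-root v)

    nearest-≢ : ∀ {S v w} → NearestIn S v w → v ≢ w
    nearest-≢ (parent-in e _) refl = parent-¬anc e self
    nearest-≢ (skip e _ q)    refl = parent-¬anc e (nearest⇒anc q)

open Ancestry
  using (Anc; self; up; Desc; down; NearestIn; NoAncestorIn; parent-in; skip; parentless; Hanging; child; below)

prune-map : ∀ {n} (x c : Fin n) → Maybe (Fin n) → (Fin n → Maybe (Fin n)) → Fin n → Maybe (Fin n)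
prune-map x c m g v with v ≟F x | v ≟F c
... | yes _ | _     = nothing
... | no _  | yes _ = m
... | no _  | no _  = g v

prune-map-x : ∀ {n} (x c : Fin n) m g → prune-map x c m g x ≡ nothing
prune-map-x x c m g with x ≟F x
... | yes _   = refl
... | no x≢x = ⊥-elim (x≢x refl)

prune-map-c : ∀ {n} (x c : Fin n) m g → c ≢ x → prune-map x c m g c ≡ m
prune-map-c x c m g c≢x with c ≟F x | c ≟F c
... | yes c≡x | _       = ⊥-elim (c≢x c≡x)
... | no _    | yes _   = refl
... | no _    | no c≢c = ⊥-elim (c≢c refl)

prune-map-other : ∀ {n} (x c : Fin n) m g v → v ≢ x → v ≢ c → prune-map x c m g v ≡ g v
prune-map-other x c m g v v≢x v≢c with v ≟F x | v ≟F c
... | yes v≡x | _       = ⊥-elim (v≢x v≡x)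
... | no _    | yes v≡c = ⊥-elim (v≢c v≡c)
... | no _    | no _    = refl

module SearchTrees {n : ℕ} (G : Graph n) where

  A = Adj G

  A? : ∀ a b → Dec (A a b)
  A? a b = T? (adj G a b)

  A-sym : ∀ {a b} → A a b → A b a
  A-sym {a} {b} = Graph.sym G a b

  open Components A A? A-sym

  record SearchTreeFacts (S : Subset n) (T : RTree n) : Set where
    field
      root-parentless       : parent T (root T) ≡ nothing
      outside-parentless    : ∀ v → v ∉ S → parent T v ≡ nothing
      parent-closed         : ∀ {v w} → v ∈ S → parent T v ≡ just w → w ∈ S
      anc-root              : ∀ {v} → v ∈ S → Anc (parent T) v (root T)
      edge-comparable       : ∀ {u v} → u ∈ S → v ∈ S → A u v → Anc (parent T) u v ⊎ Anc (parent T) v u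
      descendants-connected : ∀ {v y} → v ∈ S → Anc (parent T) y v → PWalk A (λ z → Anc (parent T) z v) v y

  SubtreeOn : Subset n → RTree n → Subset n → Set
  SubtreeOn S T C = Σ (RTree n) λ T′ → IsSearchTree G C T′
                  × parent T (root T′) ≡ just (root T)
                  × (∀ v → v ∈ C → v ≢ root T′ → parent T v ≡ parent T′ v)

  module Node {S : Subset n} {T : RTree n}
      (r∈ : root T ∈ S) (r-parentless : parent T (root T) ≡ nothing)
      (outside-S-parentless : ∀ v → v ∉ S → parent T v ≡ nothing)
      (subtree : ∀ C → Component A (S - root T) C → SubtreeOn S T C)
      (subtree-facts : ∀ C (c : Component A (S - root T) C) → SearchTreeFacts C (proj₁ (subtree C c)))
      (S-connected : Connected A S) where

    r = root T
    par = parent T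
    open Ancestry par using (parent-unique; no-parent; anc-trans; anc-parentless)

    record Branch (v : Fin n) : Set where
      field
        C        : Subset n
        comp     : Component A (S - r) C
        base∈C   : v ∈ C
        T′       : RTree n
        T′-child : par (root T′) ≡ just r
        agrees   : ∀ u → u ∈ C → u ≢ root T′ → par u ≡ parent T′ u
        facts    : SearchTreeFacts C T′

      open SearchTreeFacts facts public

      C⊆S : ∀ {z} → z ∈ C → z ∈ S
      C⊆S z∈ = x∈p-y⇒x∈p S (proj₁ comp z∈)

      C∌r : ∀ {z} → z ∈ C → z ≢ r
      C∌r z∈ = x∈p-y⇒x≢y S (proj₁ comp z∈)

      anc⁺ : ∀ {a b} → a ∈ C → Anc (parent T′) a b → Anc par a b
      anc⁺ a∈ self = self
      anc⁺ {a} a∈ (up e p) with a ≟F root T′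
      ... | yes refl = ⊥-elim (Ancestry.no-parent (parent T′) root-parentless e)
      ... | no a≢r′  = up (trans (agrees a a∈ a≢r′) e) (anc⁺ (parent-closed a∈ e) p)

      anc-∈ : ∀ {z} → Anc (parent T′) z v → z ∈ C
      anc-∈ {z} a with z ∈? C
      ... | yes z∈ = z∈
      ... | no z∉  = subst (_∈ C) (sym (Ancestry.anc-parentless (parent T′) (outside-parentless z z∉) a)) base∈C

    branch : ∀ {v} → v ∈ S → v ≢ r → Branch v
    branch {v} v∈ v≢r = record
      { C = C ; comp = comp ; base∈C = ∈-component-self v∈′ ; T′ = proj₁ sub
      ; T′-child = proj₁ (proj₂ (proj₂ sub)) ; agrees = proj₂ (proj₂ (proj₂ sub))
      ; facts = subtree-facts C comp }
      where
        v∈′ = x∈p∧x≢y⇒x∈p-y v∈ v≢r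
        C = component (S - r) v
        comp = component-isComponent v∈′
        sub = subtree C comp

    parent-closed′ : ∀ {v w} → v ∈ S → par v ≡ just w → w ∈ S
    parent-closed′ {v} v∈ e with v ≟F r
    ... | yes refl = ⊥-elim (no-parent r-parentless e)
    ... | no v≢r   = via-branch (v ≟F root T′)
      where
        open Branch (branch v∈ v≢r)
        via-branch : Dec (v ≡ root T′) → _ ∈ S
        via-branch (yes v≡r′) = subst (_∈ S) (parent-unique (subst (λ z → par z ≡ just r) (sym v≡r′) T′-child) e) r∈
        via-branch (no v≢r′)  = C⊆S (parent-closed base∈C (trans (sym (agrees v base∈C v≢r′)) e))

    anc-root′ : ∀ {v} → v ∈ S → Anc par v r
    anc-root′ {v} v∈ with v ≟F r
    ... | yes refl = self
    ... | no v≢r   = anc-trans (anc⁺ base∈C (anc-root base∈C)) (up T′-child self)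
      where open Branch (branch v∈ v≢r)

    edge-comparable′ : ∀ {u v} → u ∈ S → v ∈ S → A u v → Anc par u v ⊎ Anc par v u
    edge-comparable′ {u} {v} u∈ v∈ e with u ≟F r | v ≟F r
    ... | yes refl | _        = inj₂ (anc-root′ v∈)
    ... | no _     | yes refl = inj₁ (anc-root′ u∈)
    ... | no u≢r   | no v≢r   = ⊎-map (anc⁺ base∈C) (anc⁺ v∈C) (edge-comparable base∈C v∈C e)
      where
        open Branch (branch u∈ u≢r)
        v∈C : v ∈ C
        v∈C = proj₂ (proj₂ comp) base∈C (x∈p∧x≢y⇒x∈p-y v∈ v≢r) e

    anc⁻ : ∀ {v} (b : Branch v) → ∀ {y w} → w ∈ Branch.C b → Anc par y w
         → y ∈ Branch.C b × Anc (parent (Branch.T′ b)) y w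
    anc⁻ b w∈ self = w∈ , self
    anc⁻ b {y} w∈ (up {u = u} e p) with anc⁻ b w∈ p
    ... | u∈ , q = y∈ , up (trans (sym (B.agrees y y∈ (y≢child B.T′-child))) e) q
      where
        module B = Branch b
        y∈S : y ∈ S
        y∈S with y ∈? S
        ... | yes y∈ = y∈
        ... | no y∉  = ⊥-elim (no-parent (outside-S-parentless y y∉) e)
        y≢r : y ≢ r
        y≢r refl = no-parent r-parentless e
        y≢child : ∀ {z} → par z ≡ just r → y ≢ z
        y≢child e′ refl = B.C∌r u∈ (parent-unique e e′)
        module By = Branch (branch y∈S y≢r)
        u∈Cy : u ∈ By.C
        u∈Cy = By.parent-closed By.base∈C (trans (sym (By.agrees y By.base∈C (y≢child By.T′-child))) e)
        -- u lies in the branches of both y and w, so these are the same component of S - r.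
        y∈ : y ∈ B.C
        y∈ = component-closed B.comp u∈
               (pwalk-map (proj₁ By.comp) (walk⇒pwalk (proj₂ (proj₁ (proj₂ By.comp)) u∈Cy By.base∈C)))

    descendants-connected′ : ∀ {v y} → v ∈ S → Anc par y v → PWalk A (λ z → Anc par z v) v y
    descendants-connected′ {v} {y} v∈ a with v ≟F r
    ... | yes refl with y ∈? S
    ...   | yes y∈ = pwalk-map anc-root′ (walk⇒pwalk (proj₂ S-connected r∈ y∈))
    ...   | no y∉  = subst (PWalk A (λ z → Anc par z r) r) (sym (anc-parentless (outside-S-parentless y y∉) a)) (pnil self)
    descendants-connected′ {v} {y} v∈ a | no v≢r =
      pwalk-map (λ b → anc⁺ (anc-∈ b) b) (descendants-connected base∈C (proj₂ (anc⁻ (branch v∈ v≢r) base∈C a)))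
      where open Branch (branch v∈ v≢r)

    facts : SearchTreeFacts S T
    facts = record
      { root-parentless = r-parentless ; outside-parentless = outside-S-parentless
      ; parent-closed = parent-closed′ ; anc-root = anc-root′
      ; edge-comparable = edge-comparable′ ; descendants-connected = descendants-connected′ }

  searchTree-facts : ∀ {S T} → IsSearchTree G S T → Connected A S → SearchTreeFacts S T
  searchTree-facts (node r∈ pr out sub) S-connected =
    Node.facts r∈ pr out sub (λ C c → searchTree-facts (proj₁ (proj₂ (sub C c))) (proj₁ (proj₂ c))) S-connected

module SearchTreeOfTree {n : ℕ} (G : Graph n) (T : RTree n)
                        (G-tree : IsTree G) (T-search : IsSearchTree G ⊤ T) where

  open SearchTrees G public using (A; A?; A-sym)
  open SearchTrees.SearchTreeFacts (SearchTrees.searchTree-facts G T-search (proj₁ G-tree))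

  par = parent T
  r = root T

  r-parentless : par r ≡ nothing
  r-parentless = root-parentless

  anc-r : ∀ v → Anc par v r
  anc-r v = anc-root ∈⊤

  open Ancestry par public using (parent-unique; no-parent; anc-trans; anc-parentless; anc-comparable;
    nearest-unique; nearest-noAncestor; nearest-∈; nearest⇒anc; noAncestor-anc; anc⇒desc;
    hanging⇒anc; hanging-extend; hanging-++-nearest; hanging-++-noAncestor; hanging⇒nearest; nearest⇒hanging;
    first-hanging; noAncestor-⊆)
  open Ancestry.Rooted par r root-parentless anc-r public

  edge-anc : ∀ {u v} → A u v → Anc par u v ⊎ Anc par v u
  edge-anc = edge-comparable ∈⊤ ∈⊤

  below-connected : ∀ {v y} → Anc par y v → PWalk A (λ z → Anc par z v) v y
  below-connected = descendants-connected ∈⊤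

  siblings-disjoint : ∀ {l d₁ d₂ z} → par d₁ ≡ just l → par d₂ ≡ just l → Anc par z d₁ → Anc par z d₂ → d₁ ≡ d₂
  siblings-disjoint e₁ e₂ a₁ a₂ with anc-comparable a₁ a₂
  ... | inj₁ self      = refl
  ... | inj₁ (up e p)  = ⊥-elim (parent-¬anc e₂ (subst (λ z → Anc par z _) (parent-unique e e₁) p))
  ... | inj₂ self      = refl
  ... | inj₂ (up e p)  = ⊥-elim (parent-¬anc e₁ (subst (λ z → Anc par z _) (parent-unique e e₂) p))

  -- The walk from l down to d inside the subtree of l enters the subtree of d through l itself.
  child-subtree-adjacent : ∀ {l d} → par d ≡ just l → Σ _ λ w → Anc par w d × A l w
  child-subtree-adjacent {l} {d} e
    with first-entry (λ z → anc? z d) (below-connected (up e self)) (parent-¬anc e) self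
  ... | u , w , u-l , _ , ¬u-d , w-d , u~w with edge-anc u~w
  ...   | inj₁ u-w = ⊥-elim (¬u-d (anc-trans u-w w-d))
  ...   | inj₂ w-u with anc-comparable w-d w-u
  ...     | inj₂ u-d        = ⊥-elim (¬u-d u-d)
  ...     | inj₁ self       = ⊥-elim (¬u-d self)
  ...     | inj₁ (up e′ d-u) with parent-unique e e′
  ...       | refl = w , w-d , subst (λ z → A z w) (anc-antisym u-l d-u) u~w

  -- Each child subtree of l contains a G-neighbour of l, so such a walk would close a cycle through l.
  no-walk-between-siblings : ∀ {X : Fin n → Set} {l d₁ d₂ y₁ y₂} → ¬ X l
    → par d₁ ≡ just l → par d₂ ≡ just l → d₁ ≢ d₂
    → Anc par y₁ d₁ → Anc par y₂ d₂ → ¬ PWalk A X y₁ y₂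
  no-walk-between-siblings {X} {l} {d₁} {d₂} ¬Xl e₁ e₂ d₁≢d₂ a₁ a₂ q
    with child-subtree-adjacent e₁ | child-subtree-adjacent e₂
  ... | z₁ , z₁-d₁ , l~z₁ | z₂ , z₂-d₂ , l~z₂ =
    acyclic⇒no-detour (proj₂ G-tree) ¬Yl l~z₁ (A-sym l~z₂) z₁≢z₂ walk
    where
      Y : Fin n → Set
      Y z = X z ⊎ (Anc par z d₁ ⊎ Anc par z d₂)
      ¬Yl : ¬ Y l
      ¬Yl (inj₁ x)        = ¬Xl x
      ¬Yl (inj₂ (inj₁ a)) = parent-¬anc e₁ a
      ¬Yl (inj₂ (inj₂ a)) = parent-¬anc e₂ a
      z₁≢z₂ : z₁ ≢ z₂
      z₁≢z₂ refl = d₁≢d₂ (siblings-disjoint e₁ e₂ z₁-d₁ z₂-d₂)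
      in₁ : ∀ {z} → Anc par z d₁ → Y z
      in₁ a = inj₂ (inj₁ a)
      in₂ : ∀ {z} → Anc par z d₂ → Y z
      in₂ a = inj₂ (inj₂ a)
      walk : PWalk A Y z₁ z₂
      walk = pwalk-++ (pwalk-map in₁ (pwalk-reverse A-sym (below-connected z₁-d₁)))
            (pwalk-++ (pwalk-map in₁ (below-connected a₁))
            (pwalk-++ (pwalk-map inj₁ q)
            (pwalk-++ (pwalk-map in₂ (pwalk-reverse A-sym (below-connected a₂)))
                      (pwalk-map in₂ (below-connected z₂-d₂)))))

  WalkConnected : Subset n → Set
  WalkConnected S = ∀ {a b} → a ∈ S → b ∈ S → PWalk A (_∈ S) a b

  module _ {S : Subset n} where

    -- Otherwise the S-walk between v₁ and v₂ would join two child subtrees of a vertex outside S.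
    at-most-one-hanging : WalkConnected S
      → ∀ {l v₁ v₂} → l ∉ S → Hanging par S l v₁ → Hanging par S l v₂ → v₁ ∈ S → v₂ ∈ S → v₁ ≡ v₂
    at-most-one-hanging S-conn {v₁ = v₁} {v₂} l∉ h₁ h₂ v₁∈ v₂∈ with v₁ ≟F v₂
    ... | yes v₁≡v₂ = v₁≡v₂
    ... | no v₁≢v₂  = ⊥-elim (apart l∉ h₁ h₂)
      where
        split : ∀ {l d₁ d₂} → l ∉ S → par d₁ ≡ just l → par d₂ ≡ just l → d₁ ≢ d₂
              → Anc par v₁ d₁ → Anc par v₂ d₂ → ⊥
        split l∉ e₁ e₂ d₁≢d₂ a₁ a₂ = no-walk-between-siblings l∉ e₁ e₂ d₁≢d₂ a₁ a₂ (S-conn v₁∈ v₂∈)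
        apart : ∀ {l} → l ∉ S → Hanging par S l v₁ → Hanging par S l v₂ → ⊥
        apart l∉ (child e₁) (child e₂) = split l∉ e₁ e₂ v₁≢v₂ self self
        apart l∉ (child e₁) (below e₂ d∉ h₂) =
          split l∉ e₁ e₂ (λ { refl → d∉ v₁∈ }) self (hanging⇒anc h₂)
        apart l∉ (below e₁ d∉ h₁) (child e₂) =
          split l∉ e₁ e₂ (λ { refl → d∉ v₂∈ }) (hanging⇒anc h₁) self
        apart l∉ (below {d₁} e₁ d₁∉ h₁) (below {d₂} e₂ _ h₂) with d₁ ≟F d₂
        ... | yes refl   = apart d₁∉ h₁ h₂
        ... | no d₁≢d₂  = split l∉ e₁ e₂ d₁≢d₂ (hanging⇒anc h₁) (hanging⇒anc h₂)

    -- An S-walk cannot leave the subtree of a: the edge leaving it would reach an S-ancestor of a.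
    noAncestor-anc-all : ∀ {a b} → NoAncestorIn par S a → PWalk A (_∈ S) a b → Anc par b a
    noAncestor-anc-all {a} none = pwalk-invariant edge-step self
      where
        edge-step : ∀ {u w} → Anc par u a → u ∈ S → A u w → w ∈ S → Anc par w a
        edge-step u-a _ u~w w∈ with edge-anc u~w
        ... | inj₂ w-u = anc-trans w-u u-a
        ... | inj₁ u-w with anc-comparable u-w u-a
        ...   | inj₁ w-a = w-a
        ...   | inj₂ a-w = subst (λ z → Anc par z a) (noAncestor-anc none a-w w∈) self

    noAncestor-unique : WalkConnected S
      → ∀ {a b} → a ∈ S → b ∈ S → NoAncestorIn par S a → NoAncestorIn par S b → a ≡ b
    noAncestor-unique S-conn a∈ b∈ none-a none-b =
      sym (noAncestor-anc none-b (noAncestor-anc-all none-a (S-conn a∈ b∈)) a∈)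

module Projection {n : ℕ} (G : Graph n) (T : RTree n)
                  (G-tree : IsTree G) (T-search : IsSearchTree G ⊤ T) where

  open SearchTreeOfTree G T G-tree T-search public

  record ParentCorrect (S : Subset n) (R : RTree n) (v : Fin n) : Set where
    constructor parentCorrect
    field
      when-nearest    : ∀ {w} → NearestIn par S v w → parent R v ≡ just w
      when-noAncestor : NoAncestorIn par S v → parent R v ≡ nothing

  module _ {S : Subset n} {R : RTree n} {v : Fin n} where

    correct-nearest : ∀ {w} → NearestIn par S v w → parent R v ≡ just w → ParentCorrect S R v
    correct-nearest q e =
      parentCorrect (λ q′ → trans e (cong just (nearest-unique q q′))) (λ none → ⊥-elim (nearest-noAncestor q none))

    correct-noAncestor : NoAncestorIn par S v → parent R v ≡ nothing → ParentCorrect S R v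
    correct-noAncestor none e = parentCorrect (λ q → ⊥-elim (nearest-noAncestor q none)) (λ _ → e)

    correct-transfer : ∀ {R′ : RTree n} → parent R v ≡ parent R′ v → ParentCorrect S R′ v → ParentCorrect S R v
    correct-transfer e (parentCorrect near none) = parentCorrect (λ q → trans e (near q)) (λ q → trans e (none q))

  record NearestAncestorTree (S : Subset n) (R : RTree n) : Set where
    field
      outside-parentless : ∀ v → v ∉ S → parent R v ≡ nothing
      parent-correct     : ∀ {v} → v ∈ S → ParentCorrect S R v
      root-∈             : root R ∈ S
      root-noAncestor    : NoAncestorIn par S (root R)

    parent-nearest : ∀ {v w} → v ∈ S → NearestIn par S v w → parent R v ≡ just w
    parent-nearest v∈ = ParentCorrect.when-nearest (parent-correct v∈)

    parent-noAncestor : ∀ {v} → v ∈ S → NoAncestorIn par S v → parent R v ≡ nothing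
    parent-noAncestor v∈ = ParentCorrect.when-noAncestor (parent-correct v∈)

    open Ancestry (parent R) using () renaming (no-parent to no-parentᴿ; parent-unique to parent-uniqueᴿ)

    parent⇒nearest : ∀ {v w} → parent R v ≡ just w → v ∈ S × NearestIn par S v w
    parent⇒nearest {v} e with v ∈? S
    ... | no v∉  = ⊥-elim (no-parentᴿ (outside-parentless v v∉) e)
    ... | yes v∈ with nearest-or-noAncestor-at S v
    ...   | inj₁ (_ , q) = v∈ , subst (NearestIn par S v) (parent-uniqueᴿ (parent-nearest v∈ q) e) q
    ...   | inj₂ none    = ⊥-elim (no-parentᴿ (parent-noAncestor v∈ none) e)

    parentless⇒noAncestor : ∀ {v} → v ∈ S → parent R v ≡ nothing → NoAncestorIn par S v
    parentless⇒noAncestor {v} v∈ e with nearest-or-noAncestor-at S v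
    ... | inj₁ (_ , q) = ⊥-elim (no-parentᴿ e (parent-nearest v∈ q))
    ... | inj₂ none    = none

    root-parentless : parent R (root R) ≡ nothing
    root-parentless = parent-noAncestor root-∈ root-noAncestor

  whole-nearestAncestorTree : ∀ {S R} → (∀ v → v ∈ S) → root R ≡ r → (∀ v → parent R v ≡ par v)
                            → NearestAncestorTree S R
  whole-nearestAncestorTree {S} {R} all-S root≡ parent≡ = record
    { outside-parentless = λ v v∉ → ⊥-elim (v∉ (all-S v))
    ; parent-correct = correct
    ; root-∈ = all-S _
    ; root-noAncestor = parentless (subst (λ z → par z ≡ nothing) (sym root≡) r-parentless) }
    where
      correct : ∀ {v} → v ∈ S → ParentCorrect S R v
      correct {v} _ with par v in e
      ... | just w  = correct-nearest (parent-in e (all-S w)) (trans (parent≡ v) e)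
      ... | nothing = correct-noAncestor (parentless e) (trans (parent≡ v) e)

  module Extension (S : Subset n) (x : Fin n) (x∉ : x ∉ S) where

    S′ : Subset n
    S′ = S ∪ ⁅ x ⁆

    S⊆S′ : S ⊆ S′
    S⊆S′ v∈ = x∈p∪q⁺ (inj₁ v∈)

    x∈S′ : x ∈ S′
    x∈S′ = x∈p∪q⁺ (inj₂ (x∈⁅x⁆ x))

    ∈S′⇒∈S : ∀ {v} → v ∈ S′ → v ≢ x → v ∈ S
    ∈S′⇒∈S {v} v∈ v≢x with x∈p∪q⁻ S ⁅ x ⁆ v∈
    ... | inj₁ v∈S = v∈S
    ... | inj₂ v∈x = ⊥-elim (v≢x (x∈⁅y⁆⇒x≡y x v∈x))

    ∈S⇒≢x : ∀ {v} → v ∈ S → v ≢ x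
    ∈S⇒≢x v∈ refl = x∉ v∈

    nearest-via-x : ∀ {v p} → NearestIn par S′ v x → NearestIn par S′ x p → NearestIn par S v p
    nearest-via-x q q′ = hanging-++-nearest (nearest⇒hanging S⊆S′ q) x∉
                           (hanging⇒nearest (nearest⇒hanging S⊆S′ q′) (∈S′⇒∈S (nearest-∈ q′) (λ p≡x → nearest-≢ q′ (sym p≡x))))

    noAncestor-via-x : ∀ {v} → NearestIn par S′ v x → NoAncestorIn par S′ x → NoAncestorIn par S v
    noAncestor-via-x q none = hanging-++-noAncestor (nearest⇒hanging S⊆S′ q) x∉ (noAncestor-⊆ S⊆S′ none)

    module _ {R′ : RTree n} (tree′ : NearestAncestorTree S′ R′) where
      open NearestAncestorTree tree′

      child-of-x-∈ : ∀ {c} → parent R′ c ≡ just x → c ∈ S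
      child-of-x-∈ e = ∈S′⇒∈S (proj₁ (parent⇒nearest e)) (nearest-≢ (proj₂ (parent⇒nearest e)))

      not-child-of-x-correct : ∀ {v} → v ∈ S → parent R′ v ≢ just x → ParentCorrect S R′ v
      not-child-of-x-correct {v} v∈ ¬child with nearest-or-noAncestor-at S′ v
      ... | inj₂ none = correct-noAncestor (noAncestor-⊆ S⊆S′ none) (parent-noAncestor (S⊆S′ v∈) none)
      ... | inj₁ (w , q) with w ≟F x
      ...   | yes refl = ⊥-elim (¬child (parent-nearest (S⊆S′ v∈) q))
      ...   | no w≢x   = correct-nearest (hanging⇒nearest (nearest⇒hanging S⊆S′ q) (∈S′⇒∈S (nearest-∈ q) w≢x))
                           (parent-nearest (S⊆S′ v∈) q)

      pruned-tree : ∀ {R} → parent R x ≡ nothing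
        → (∀ v → v ∉ S → v ≢ x → parent R v ≡ parent R′ v)
        → (∀ {v} → v ∈ S → ParentCorrect S R v ⊎ (parent R v ≡ parent R′ v × parent R′ v ≢ just x))
        → root R ∈ S → NoAncestorIn par S (root R) → NearestAncestorTree S R
      pruned-tree {R} x-parentless kept-outside correct-inside root∈ root-none = record
        { outside-parentless = outside ; parent-correct = correct
        ; root-∈ = root∈ ; root-noAncestor = root-none }
        where
          outside : ∀ v → v ∉ S → parent R v ≡ nothing
          outside v v∉ with v ≟F x
          ... | yes refl = x-parentless
          ... | no v≢x   = trans (kept-outside v v∉ v≢x) (outside-parentless v (λ v∈ → v∉ (∈S′⇒∈S v∈ v≢x)))
          correct : ∀ {v} → v ∈ S → ParentCorrect S R v
          correct v∈ with correct-inside v∈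
          ... | inj₁ c             = c
          ... | inj₂ (e , ¬child) = correct-transfer e (not-child-of-x-correct v∈ ¬child)

      root-kept : ∀ {R p} → root R ≡ root R′ → parent R′ x ≡ just p → root R ∈ S × NoAncestorIn par S (root R)
      root-kept root≡ ex =
          subst (_∈ S) (sym root≡) (∈S′⇒∈S root-∈ (λ { refl → Ancestry.no-parent (parent R′) root-parentless ex }))
        , subst (NoAncestorIn par S) (sym root≡) (noAncestor-⊆ S⊆S′ root-noAncestor)

      prune-nearestAncestorTree : ∀ {R} → Prune R′ x R → NearestAncestorTree S R
      prune-nearestAncestorTree {R} (noChild p ex no-child root≡ x-parentless kept) =
        pruned-tree x-parentless (λ v _ v≢x → kept v v≢x)
          (λ v∈ → inj₂ (kept _ (∈S⇒≢x v∈) , no-child _))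
          (proj₁ (root-kept {R} root≡ ex)) (proj₂ (root-kept {R} root≡ ex))
      prune-nearestAncestorTree {R} (oneChild p c ex ec only-c root≡ x-parentless ec′ kept) =
        pruned-tree x-parentless (λ v v∉ v≢x → kept v v≢x (λ { refl → v∉ c∈ })) correct-inside
          (proj₁ (root-kept {R} root≡ ex)) (proj₂ (root-kept {R} root≡ ex))
        where
          c∈ = child-of-x-∈ ec
          correct-inside : ∀ {v} → v ∈ S → ParentCorrect S R v ⊎ _
          correct-inside {v} v∈ with v ≟F c
          ... | yes refl = inj₁ (correct-nearest {R = R}
                             (nearest-via-x (proj₂ (parent⇒nearest ec)) (proj₂ (parent⇒nearest ex))) ec′)
          ... | no v≢c   = inj₂ (kept v (∈S⇒≢x v∈) v≢c , λ e → v≢c (only-c v e))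
      prune-nearestAncestorTree {R} (isRoot c root≡x ec only-c root≡ x-parentless ec′ kept) =
        pruned-tree x-parentless (λ v v∉ v≢x → kept v v≢x (λ { refl → v∉ c∈ })) correct-inside
          (subst (_∈ S) (sym root≡) c∈) (subst (NoAncestorIn par S) (sym root≡) c-none)
        where
          c∈ = child-of-x-∈ ec
          c-none : NoAncestorIn par S c
          c-none = noAncestor-via-x (proj₂ (parent⇒nearest ec)) (subst (NoAncestorIn par S′) root≡x root-noAncestor)
          correct-inside : ∀ {v} → v ∈ S → ParentCorrect S R v ⊎ _
          correct-inside {v} v∈ with v ≟F c
          ... | yes refl = inj₁ (correct-noAncestor c-none ec′)
          ... | no v≢c   = inj₂ (kept v (∈S⇒≢x v∈) v≢c , λ e → v≢c (only-c v e))

  projection-nearestAncestorTree : ∀ {S R} → Proj G T S R → NearestAncestorTree S R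
  projection-nearestAncestorTree (whole all-S root≡ parent≡) = whole-nearestAncestorTree all-S root≡ parent≡
  projection-nearestAncestorTree {S} (step x _ x∉ _ _ proj prune) =
    Extension.prune-nearestAncestorTree S x x∉ (projection-nearestAncestorTree proj) prune

  module Pruning (S : Subset n) (x : Fin n) (x∉ : x ∉ S) (s : Fin n) (s∈ : s ∈ S) (x~s : A x s)
                 (S-conn : WalkConnected S) where
    open Extension S x x∉

    to-s : ∀ {a} → a ∈ S′ → PWalk A (_∈ S′) a s
    to-s {a} a∈ with a ≟F x
    ... | yes refl = pcons x∈S′ x~s (pnil (S⊆S′ s∈))
    ... | no a≢x   = pwalk-map S⊆S′ (S-conn (∈S′⇒∈S a∈ a≢x) s∈)

    S′-connected : WalkConnected S′
    S′-connected a∈ b∈ = pwalk-++ (to-s a∈) (pwalk-reverse A-sym (to-s b∈))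

    module _ {R′ : RTree n} (tree′ : NearestAncestorTree S′ R′) where
      open NearestAncestorTree tree′

      x-child-unique : ∀ {c v} → parent R′ c ≡ just x → parent R′ v ≡ just x → v ≡ c
      x-child-unique ec ev =
        at-most-one-hanging S-conn x∉ (hanging ev) (hanging ec) (child-of-x-∈ tree′ ev) (child-of-x-∈ tree′ ec)
        where
          hanging : ∀ {v} → parent R′ v ≡ just x → Hanging par S x v
          hanging e = nearest⇒hanging S⊆S′ (proj₂ (parent⇒nearest e))

      parentless-x-is-root : parent R′ x ≡ nothing → x ≡ root R′
      parentless-x-is-root e = noAncestor-unique S′-connected x∈S′ root-∈ (parentless⇒noAncestor x∈S′ e) root-noAncestor

      -- x is an ancestor of s, and the first vertex of S′ below x on the way to s is a child of x in R′.
      parentless-x-has-child : parent R′ x ≡ nothing → ∃ λ c → parent R′ c ≡ just x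
      parentless-x-has-child e with first-hanging s-below-x (S⊆S′ s∈) (λ { refl → x∉ s∈ })
        where s-below-x = anc⇒desc (noAncestor-anc-all (parentless⇒noAncestor x∈S′ e) (S′-connected x∈S′ (S⊆S′ s∈)))
      ... | c , c∈ , h = c , parent-nearest c∈ (hanging⇒nearest h x∈S′)

      child-≢x : ∀ {c} → parent R′ c ≡ just x → c ≢ x
      child-≢x ec = nearest-≢ (proj₂ (parent⇒nearest ec))

      prune-exists : Σ (RTree n) λ R → Prune R′ x R
      prune-exists with parent R′ x in ex
      ... | just p with any? (λ v → ≡-dec _≟F_ (parent R′ v) (just x))
      ...   | no ∄c = rtree (root R′) (prune-map x x nothing (parent R′)) ,
                noChild p ex (λ v e → ∄c (v , e)) refl (prune-map-x x x nothing (parent R′))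
                  (λ v v≢x → prune-map-other x x nothing (parent R′) v v≢x v≢x)
      ...   | yes (c , ec) = rtree (root R′) (prune-map x c (just p) (parent R′)) ,
                oneChild p c ex ec (λ v e → x-child-unique ec e) refl (prune-map-x x c (just p) (parent R′))
                  (prune-map-c x c (just p) (parent R′) (child-≢x ec)) (prune-map-other x c (just p) (parent R′))
      prune-exists | nothing with parentless-x-has-child ex
      ... | c , ec = rtree c (prune-map x c nothing (parent R′)) ,
                isRoot c (sym (parentless-x-is-root ex)) ec (λ v e → x-child-unique ec e) refl
                  (prune-map-x x c nothing (parent R′)) (prune-map-c x c nothing (parent R′) (child-≢x ec))
                  (prune-map-other x c nothing (parent R′))

  -- The fuel k bounds the number of vertices outside S.
  projection-exists : ∀ k S → WalkConnected S → Nonempty S → n ≤ k + ∣ S ∣ → Σ (RTree n) λ R → Proj G T S R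
  projection-exists k S S-conn (s₀ , s₀∈) size with all? (_∈? S)
  ... | yes all-S = T , whole all-S refl (λ _ → refl)
  ... | no ¬all-S with ¬∀⟶∃¬ n (_∈ S) (_∈? S) ¬all-S
  ...   | v₀ , v₀∉ with first-entry (λ z → ¬? (z ∈? S)) G-walk (λ s₀∉ → s₀∉ s₀∈) v₀∉
    where G-walk = walk⇒pwalk (proj₂ (proj₁ G-tree) (∈⊤ {x = s₀}) (∈⊤ {x = v₀}))
  ...     | u , x , _ , _ , ¬u∉ , x∉ , u~x = grow k size
    where
      u∈ : u ∈ S
      u∈ = decidable-stable (u ∈? S) ¬u∉
      open Extension S x x∉
      open Pruning S x x∉ u u∈ (A-sym u~x) S-conn
      grow : ∀ k → n ≤ k + ∣ S ∣ → Σ (RTree n) λ R → Proj G T S R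
      grow zero    size′ = ⊥-elim (<-irrefl refl (≤-<-trans size′
                             (subst (∣ S ∣ <_) (∣⊤∣≡n n) (p⊂q⇒∣p∣<∣q∣ ((λ _ → ∈⊤) , v₀ , ∈⊤ , v₀∉)))))
      grow (suc k) size′ with projection-exists k S′ S′-connected (x , x∈S′) size″
        where
          size″ : n ≤ k + ∣ S′ ∣
          size″ = ≤-trans size′ (subst (_≤ k + ∣ S′ ∣) (+-suc k ∣ S ∣) (+-monoʳ-≤ k (p⊂q⇒∣p∣<∣q∣ (S⊆S′ , x , x∈S′ , x∉))))
      ... | R′ , proj′ with prune-exists (projection-nearestAncestorTree proj′)
      ...   | R , prune = R , step x u x∉ u∈ (A-sym u~x) proj′ prune

  TA : Rel n
  TA = TAdj T

  TA? : ∀ a b → Dec (TA a b)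
  TA? a b = ≡-dec _≟F_ (par a) (just b) ⊎-dec ≡-dec _≟F_ (par b) (just a)

  TA-sym : ∀ {a b} → TA a b → TA b a
  TA-sym (inj₁ e) = inj₂ e
  TA-sym (inj₂ e) = inj₁ e

  BoundaryShape : Subset n → Set
  BoundaryShape C = (Σ _ λ a → Σ _ λ b → a ≢ b × (∀ w → Boundary T C w ⇔ (w ≡ a ⊎ w ≡ b)))
                  ⊎ (Σ _ λ v → ∀ w → Boundary T C w ⇔ w ≡ v)

  EdgeSpec : Subset n → Fin n → Fin n → Set
  EdgeSpec S u v = (u ∈ S × v ∈ S × TA u v)
                 ⊎ (Σ _ λ C → OutComp T S C × u ≢ v × Boundary T C u × Boundary T C v)

  edgeSpec-sym : ∀ {S u v} → EdgeSpec S u v → EdgeSpec S v u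
  edgeSpec-sym (inj₁ (u∈ , v∈ , e))            = inj₁ (v∈ , u∈ , TA-sym e)
  edgeSpec-sym (inj₂ (C , c , u≢v , bu , bv)) = inj₂ (C , c , (λ v≡u → u≢v (sym v≡u)) , bv , bu)

  module Description (S : Subset n) (S-conn : WalkConnected S) {R : RTree n} (tree : NearestAncestorTree S R) where
    open NearestAncestorTree tree

    module OutsideComponent {C : Subset n} (C-comp : OutComp T S C) where

      C∌S : ∀ {c} → c ∈ C → c ∉ S
      C∌S c∈ = x∈∁p⇒x∉p (proj₁ C-comp c∈)

      C-closed : ∀ {u w} → u ∈ C → w ∉ S → TA u w → w ∈ C
      C-closed u∈ w∉ e = proj₂ (proj₂ C-comp) u∈ (x∉p⇒x∈∁p w∉) e

      C-connected : ∀ {a b} → a ∈ C → b ∈ C → PWalk TA (_∈ C) a b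
      C-connected a∈ b∈ = walk⇒pwalk (proj₂ (proj₁ (proj₂ C-comp)) a∈ b∈)

      child-outside-∈S : ∀ {y c} → y ∉ C → c ∈ C → par y ≡ just c → y ∈ S
      child-outside-∈S {y} y∉ c∈ e with y ∈? S
      ... | yes y∈  = y∈
      ... | no y∉S = ⊥-elim (y∉ (C-closed c∈ y∉S (inj₂ e)))

      IsTop : Fin n → Set
      IsTop t = t ∈ C × (∀ {p} → par t ≡ just p → p ∉ C)

      top-exists : ∃ IsTop
      top-exists = climb (proj₂ (proj₁ (proj₁ (proj₂ C-comp)))) (anc-r _)
        where
          climb : ∀ {c} → c ∈ C → Anc par c r → ∃ IsTop
          climb c∈ self = _ , c∈ , λ e → ⊥-elim (no-parent r-parentless e)
          climb c∈ (up {u = u} e p) with u ∈? C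
          ... | yes u∈ = climb u∈ p
          ... | no u∉  = _ , c∈ , λ e′ → subst (_∉ C) (parent-unique e e′) u∉

      LowerBoundary : Fin n → Set
      LowerBoundary y = y ∈ S × ∃ λ c → c ∈ C × par y ≡ just c

      lowerBoundary? : ∀ y → Dec (LowerBoundary y)
      lowerBoundary? y = (y ∈? S) ×-dec parent-in-C?
        where
          parent-in-C? : Dec (∃ λ c → c ∈ C × par y ≡ just c)
          parent-in-C? with par y
          ... | nothing = no λ { (_ , _ , ()) }
          ... | just c with c ∈? C
          ...   | yes c∈ = yes (c , c∈ , refl)
          ...   | no c∉  = no λ { (_ , c′∈ , refl) → c∉ c′∈ }

      module Top {t : Fin n} (top : IsTop t) where

        t∈ : t ∈ C
        t∈ = proj₁ top

        below-top : ∀ {y} → y ∈ C → Anc par y t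
        below-top y∈ = pwalk-invariant edge-step self (C-connected t∈ y∈)
          where
            edge-step : ∀ {u w} → Anc par u t → u ∈ C → TA u w → w ∈ C → Anc par w t
            edge-step self      _ (inj₁ e) w∈ = ⊥-elim (proj₂ top e w∈)
            edge-step (up e′ q) _ (inj₁ e) _  = subst (λ z → Anc par z t) (parent-unique e′ e) q
            edge-step u-t       _ (inj₂ e) _  = up e u-t

        -- The walk inside C from t to c enters the subtree of m through m itself.
        convex : ∀ {c m} → c ∈ C → Anc par c m → Anc par m t → m ∈ C
        convex {c} {m} c∈ c-m m-t with m ≟F t
        ... | yes refl = t∈
        ... | no m≢t with first-entry (λ z → anc? z m) (C-connected t∈ c∈) (λ t-m → m≢t (anc-antisym m-t t-m)) c-m
        ...   | _ , _ , _ , _  , ¬u-m , w-m      , inj₁ e = ⊥-elim (¬u-m (up e w-m))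
        ...   | _ , _ , _ , w∈ , _    , self     , inj₂ _ = w∈
        ...   | _ , _ , _ , _  , ¬u-m , up e′ q , inj₂ e = ⊥-elim (¬u-m (subst (λ z → Anc par z m) (parent-unique e′ e) q))

        boundary⇒ : ∀ {w} → Boundary T C w → par t ≡ just w ⊎ LowerBoundary w
        boundary⇒ (w∉ , u , u∈ , inj₁ e) = inj₂ (child-outside-∈S w∉ u∈ e , u , u∈ , e)
        boundary⇒ (w∉ , u , u∈ , inj₂ e) with below-top u∈
        ... | self    = inj₁ e
        ... | up e′ q = ⊥-elim (w∉ (convex u∈ (up e self) (subst (λ z → Anc par z t) (parent-unique e′ e) q)))

        boundary⇐ : ∀ {w} → par t ≡ just w ⊎ LowerBoundary w → Boundary T C w
        boundary⇐ (inj₁ e)                  = proj₂ top e , t , t∈ , inj₂ e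
        boundary⇐ (inj₂ (w∈ , c , c∈ , e)) = (λ w∈C → C∌S w∈C w∈) , c , c∈ , inj₁ e

        hanging-from-top : ∀ {y c} → par y ≡ just c → c ∈ C → Anc par c t → Hanging par S t y
        hanging-from-top e c∈ self      = child e
        hanging-from-top e c∈ (up e′ q) = hanging-extend (hanging-from-top e′ (convex c∈ (up e′ self) q) q) e (C∌S c∈)

        lowerBoundary-hanging : ∀ {y} → LowerBoundary y → Hanging par S t y
        lowerBoundary-hanging (_ , c , c∈ , e) = hanging-from-top e c∈ (below-top c∈)

        lowerBoundary-unique : ∀ {y₁ y₂} → LowerBoundary y₁ → LowerBoundary y₂ → y₁ ≡ y₂
        lowerBoundary-unique b₁ b₂ =
          at-most-one-hanging S-conn (C∌S t∈) (lowerBoundary-hanging b₁) (lowerBoundary-hanging b₂) (proj₁ b₁) (proj₁ b₂)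

        upper-∈S : ∀ {p} → par t ≡ just p → p ∈ S
        upper-∈S {p} e with p ∈? S
        ... | yes p∈ = p∈
        ... | no p∉  = ⊥-elim (proj₂ top e (C-closed t∈ p∉ (inj₁ e)))

        lowerBoundary-nearest : ∀ {p y} → par t ≡ just p → LowerBoundary y → NearestIn par S y p
        lowerBoundary-nearest e b = hanging-++-nearest (lowerBoundary-hanging b) (C∌S t∈) (parent-in e (upper-∈S e))

        boundary-with-lower : ∀ {p y} → par t ≡ just p → LowerBoundary y → ∀ w → Boundary T C w ⇔ (w ≡ p ⊎ w ≡ y)
        boundary-with-lower {p} {y} ep b w = mk⇔ to from
          where
            to : Boundary T C w → w ≡ p ⊎ w ≡ y
            to bw with boundary⇒ bw
            ... | inj₁ e  = inj₁ (parent-unique e ep)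
            ... | inj₂ b′ = inj₂ (lowerBoundary-unique b′ b)
            from : w ≡ p ⊎ w ≡ y → Boundary T C w
            from (inj₁ refl) = boundary⇐ (inj₁ ep)
            from (inj₂ refl) = boundary⇐ (inj₂ b)

        boundary-without-lower : ∀ {p} → par t ≡ just p → (∀ y → ¬ LowerBoundary y) → ∀ w → Boundary T C w ⇔ w ≡ p
        boundary-without-lower {p} ep ∄b w = mk⇔ to from
          where
            to : Boundary T C w → w ≡ p
            to bw with boundary⇒ bw
            ... | inj₁ e = parent-unique e ep
            ... | inj₂ b = ⊥-elim (∄b w b)
            from : w ≡ p → Boundary T C w
            from refl = boundary⇐ (inj₁ ep)

      -- The proper ancestors of root R lie outside S up to r ∈ C, so root R hangs below C.
      root-component-boundary : r ∈ C → ∀ w → Boundary T C w ⇔ w ≡ root R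
      root-component-boundary r∈C w = mk⇔ to from
        where
          open Top {r} (r∈C , λ e → ⊥-elim (no-parent r-parentless e))
          noAncestor-outside-∈C : ∀ {u} → NoAncestorIn par S u → u ∉ S → u ∈ C
          noAncestor-outside-∈C (parentless e)      _  = subst (_∈ C) (sym (parentless⇒root e)) r∈C
          noAncestor-outside-∈C (skip e u′∉ none) u∉ = C-closed (noAncestor-outside-∈C none u′∉) u∉ (inj₂ e)
          root-lower : LowerBoundary (root R)
          root-lower with root-noAncestor
          ... | parentless e    = ⊥-elim (C∌S (subst (_∈ C) (sym (parentless⇒root e)) r∈C) root-∈)
          ... | skip e u∉ none = root-∈ , _ , noAncestor-outside-∈C none u∉ , e
          to : Boundary T C w → w ≡ root R
          to bw with boundary⇒ bw
          ... | inj₁ e = ⊥-elim (no-parent r-parentless e)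
          ... | inj₂ b = lowerBoundary-unique b root-lower
          from : w ≡ root R → Boundary T C w
          from refl = boundary⇐ (inj₂ root-lower)

      private module T₀ = Top (proj₂ top-exists)

      boundary-shape : BoundaryShape C
      boundary-shape = from-upper (par (proj₁ top-exists)) refl
        where
          from-upper : ∀ m → par (proj₁ top-exists) ≡ m → BoundaryShape C
          from-upper nothing ep =
            inj₂ (root R , root-component-boundary (subst (_∈ C) (parentless⇒root ep) T₀.t∈))
          from-upper (just p) ep with any? lowerBoundary?
          ... | yes (y , b) = inj₁ (p , y , p≢y , T₀.boundary-with-lower ep b)
            where
              p≢y : p ≢ y
              p≢y refl = nearest-≢ (T₀.lowerBoundary-nearest ep b) refl
          ... | no ∄b = inj₂ (p , T₀.boundary-without-lower ep (λ y b → ∄b (y , b)))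

      boundaries-adjacent : ∀ {u v} → u ≢ v → Boundary T C u → Boundary T C v → TAdj R u v
      boundaries-adjacent u≢v bu bv with T₀.boundary⇒ bu | T₀.boundary⇒ bv
      ... | inj₁ eu | inj₁ ev = ⊥-elim (u≢v (parent-unique eu ev))
      ... | inj₂ b  | inj₂ b′ = ⊥-elim (u≢v (T₀.lowerBoundary-unique b b′))
      ... | inj₂ b  | inj₁ ev = inj₁ (parent-nearest (proj₁ b) (T₀.lowerBoundary-nearest ev b))
      ... | inj₁ eu | inj₂ b′ = inj₂ (parent-nearest (proj₁ b′) (T₀.lowerBoundary-nearest eu b′))

      nearest-exit : ∀ {y v} → y ∈ C → NearestIn par S y v → ∃ λ t → t ∈ C × par t ≡ just v
      nearest-exit y∈ (parent-in e _) = _ , y∈ , e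
      nearest-exit y∈ (skip e u∉ q)   = nearest-exit (C-closed y∈ u∉ (inj₁ e)) q

      -- The ancestors skipped between u and its nearest S-ancestor v lie in C, so u and v bound C.
      skipped-boundaries : ∀ {u u₁ v} → u₁ ∈ C → u ∈ S → par u ≡ just u₁ → NearestIn par S u₁ v
                         → Boundary T C u × Boundary T C v
      skipped-boundaries u₁∈ u∈ e q with nearest-exit u₁∈ q
      ... | t , t∈ , et = ((λ u∈C → C∌S u∈C u∈) , _ , u₁∈ , inj₁ e)
                        , ((λ v∈C → C∌S v∈C (nearest-∈ q)) , t , t∈ , inj₂ et)

    open Components TA TA? TA-sym using (component; component-isComponent; ∈-component-self)

    parent⇒edgeSpec : ∀ {u v} → parent R u ≡ just v → EdgeSpec S u v
    parent⇒edgeSpec e with parent⇒nearest e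
    ... | u∈ , parent-in e′ v∈            = inj₁ (u∈ , v∈ , inj₁ e′)
    ... | u∈ , q@(skip {u = u₁} e′ u₁∉ q′) =
      inj₂ (_ , C-comp , nearest-≢ q , OutsideComponent.skipped-boundaries C-comp (∈-component-self u₁∈∁S) u∈ e′ q′)
      where
        u₁∈∁S = x∉p⇒x∈∁p u₁∉
        C-comp : OutComp T S (component (∁ S) u₁)
        C-comp = component-isComponent u₁∈∁S

    adj⇒edgeSpec : ∀ {u v} → TAdj R u v → EdgeSpec S u v
    adj⇒edgeSpec (inj₁ e) = parent⇒edgeSpec e
    adj⇒edgeSpec (inj₂ e) = edgeSpec-sym (parent⇒edgeSpec e)

    edgeSpec⇒adj : ∀ {u v} → EdgeSpec S u v → TAdj R u v
    edgeSpec⇒adj (inj₁ (u∈ , v∈ , inj₁ e))           = inj₁ (parent-nearest u∈ (parent-in e v∈))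
    edgeSpec⇒adj (inj₁ (u∈ , v∈ , inj₂ e))           = inj₂ (parent-nearest v∈ (parent-in e u∈))
    edgeSpec⇒adj (inj₂ (C , C-comp , u≢v , bu , bv)) = OutsideComponent.boundaries-adjacent C-comp u≢v bu bv

    described : Described T S R
    described = record
      { shape   = λ C C-comp → OutsideComponent.boundary-shape C-comp
      ; edges   = λ u v → mk⇔ adj⇒edgeSpec edgeSpec⇒adj
      ; rootIn  = λ r∈ → noAncestor-anc root-noAncestor (anc-r (root R)) r∈
      ; rootOut = λ C C-comp r∈C → OutsideComponent.root-component-boundary C-comp r∈C }

mainTheorem2 : ∀ {n} (G : Graph n) (T : RTree n) (S : Subset n)
               → IsTree G → IsSearchTree G ⊤ T → Connected (Adj G) S
               → (Σ (RTree n) λ R → Proj G T S R)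
                 × (∀ R → Proj G T S R → Described T S R)
mainTheorem2 {n} G T S G-tree T-search (S-nonempty , S-walks) =
    projection-exists n S S-connected S-nonempty (m≤m+n n ∣ S ∣)
  , λ R proj → Description.described S S-connected (projection-nearestAncestorTree proj)
  where
    open Projection G T G-tree T-search
    S-connected : WalkConnected S
    S-connected a∈ b∈ = walk⇒pwalk (S-walks a∈ b∈)
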